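{- Let $T$ be an indeterminate string with $k$ non-solid symbols and let $S$ be a cover of $T$. If $S$ is not a $\odot$-prefix of $T$, then $S$ has a covering set of size at most $2k$.
   Context: An indeterminate string (i-string) $T$ of length $n$ over a finite alphabet $\Sigma$ is a sequence of nonempty subsets of $\Sigma$; singleton positions are solid, others non-solid. Two i-strings $U,V$ match ($U\approx V$) if $|U|=|V|$ and $U[i]\cap V[i]\ne\emptyset$ for all $i$. $U$ occurs in $T$ at $j$ if $U\approx T[j..j+|U|-1]$; $\mathit{Occ}(U,T)$ is the set of occurrences. For an i-string $U$ of length $m$ and $i\in\mathit{Occ}(U,T)$, $U\odot i$ denotes $U[1]\cap T[i],\ldots,U[m]\cap T[i+m-1]$. A $\odot$-prefix of $T$ is a solid string $S$ with $S=T[1..|S|]\odot i$ for some position $i$. A cover of $T$ is a solid string $S$ such that every position $i$ of $T$ satisfies $\mathit{Occ}(S,T)\cap\{i-|S|+1,\ldots,i\}\ne\emptyset$; a covering set of $S$ is any subset $\mathcal{C}\subseteq\mathit{Occ}(S,T)$ such that every position $i$ of $T$ satisfies $\mathcal{C}\cap\{i-|S|+1,\ldots,i\}\ne\emptyset$. -}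

module Defs where

open import Data.Nat using (ℕ; zero; suc; _+_; _*_; _≤_; _<_)
open import Data.Nat.Properties using (+-monoʳ-<; <-≤-trans; _≟_)
open import Data.Fin using (Fin; toℕ; fromℕ<)
open import Data.Fin.Properties using (toℕ<n)
open import Data.Fin.Subset using (Subset; _∈_; _∩_; ⁅_⁆; ∣_∣; Nonempty)
open import Data.Vec using (Vec; lookup; count)
open import Data.List using (List; length)
open import Data.List.Relation.Unary.All using (All)
open import Data.List.Relation.Unary.Any using (Any)
open import Data.Product using (Σ; ∃; _×_)
open import Relation.Binary.PropositionalEquality using (_≡_)
open import Relation.Nullary using (¬_; ¬?)

-- Alphabet Σ = Fin σ.  Positions are 0-indexed natural numbers.

-- An indeterminate string of length n over Fin σ: a vector of subsets
-- (nonemptiness of every entry is imposed separately by IsIString).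
IString : ℕ → ℕ → Set
IString σ n = Vec (Subset σ) n

IsIString : ∀ {σ n} → IString σ n → Set
IsIString {n = n} T = (i : Fin n) → Nonempty (lookup T i)

Solid : ℕ → ℕ → Set
Solid σ m = Vec (Fin σ) m

pos : ∀ {m n} (j : ℕ) (t : Fin m) → j + m ≤ n → Fin n
pos {m} j t le = fromℕ< (<-≤-trans (+-monoʳ-< j (toℕ<n t)) le)

OccursAt : ∀ {σ m n} → Solid σ m → IString σ n → ℕ → Set
OccursAt {m = m} {n} S T j =
  Σ (j + m ≤ n) λ le → (t : Fin m) → lookup S t ∈ lookup T (pos j t le)

CoveredBy : ∀ {n} (m : ℕ) → List ℕ → Fin n → Set
CoveredBy m C i = Any (λ j → j ≤ toℕ i × toℕ i < j + m) C

IsCoveringSet : ∀ {σ m n} → Solid σ m → IString σ n → List ℕ → Set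
IsCoveringSet {m = m} {n} S T C =
  All (OccursAt S T) C × ((i : Fin n) → CoveredBy m C i)

IsCover : ∀ {σ m n} → Solid σ m → IString σ n → Set
IsCover {m = m} {n} S T =
  (i : Fin n) → ∃ λ j → OccursAt S T j × j ≤ toℕ i × toℕ i < j + m

-- S is a ⊙-prefix of T: |S| ≤ n and there is i ∈ Occ(T[1..|S|], T) with
-- T[1..|S|] ⊙ i = S, i.e. T[t] ∩ T[i+t] = {S[t]} for every t < |S|.
IsOdotPrefix : ∀ {σ m n} → Solid σ m → IString σ n → Set
IsOdotPrefix {m = m} {n} S T =
  Σ (m ≤ n) λ m≤n → ∃ λ i → Σ (i + m ≤ n) λ le →
    (t : Fin m) →
      Nonempty (lookup T (pos 0 t m≤n) ∩ lookup T (pos i t le))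
      × (lookup T (pos 0 t m≤n) ∩ lookup T (pos i t le) ≡ ⁅ lookup S t ⁆)

nonSolid : ∀ {σ n} → IString σ n → ℕ
nonSolid T = count (λ A → ¬? (∣ A ∣ ≟ 1)) T

-- An occurrence of S lying entirely on solid positions of T would, together
-- with the occurrence at 0 that the cover forces, make S a ⊙-prefix. So every
-- occurrence passes through a non-solid position p, and any position covered
-- by an occurrence through p is already covered by the leftmost or the
-- rightmost occurrence through p. Two occurrences per non-solid position suffice.
module Submission where

open import Level using (Level)
open import Data.Bool using (Bool; true; false; if_then_else_)
open import Data.Nat using (ℕ; suc; _+_; _*_; _≤_; _<_; z≤n; s≤s; _≤?_; _<?_)
open import Data.Nat.Properties
open import Data.Fin as Fin using (Fin; toℕ)
open import Data.Fin.Properties using (toℕ<n; toℕ-fromℕ<; all?; ¬∀⟶∃¬)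
open import Data.Fin.Subset using (Subset; _∈_; _⊆_; _∩_; ⁅_⁆; ∣_∣)
open import Data.Fin.Subset.Properties
  using (_∈?_; x∈⁅x⁆; x∈⁅y⁆⇒x≡y; x≢y⇒x∉⁅y⁆; ∣⁅x⁆∣≡1
        ; ⊆-antisym; p⊂q⇒∣p∣<∣q∣; p∩q⊆q; x∈p∩q⁺)
open import Data.Vec using (Vec; lookup; count; _∷_; [])
open import Data.List using (List; length; []; _∷_; _++_; concat; tabulate; upTo; filter)
open import Data.List.Properties using (length-++)
open import Data.List.Membership.Propositional using () renaming (_∈_ to _∈ˡ_)
open import Data.List.Membership.Propositional.Properties using (∈-upTo⁺; ∈-filter⁺)
open import Data.List.Relation.Unary.All as All using (All; []; _∷_)
open import Data.List.Relation.Unary.All.Properties using (all-filter; concat⁺; tabulate⁺)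
open import Data.List.Relation.Unary.Any using (Any; here; there)
import Data.List.Relation.Unary.Any.Properties as Any
open import Data.List.Extrema.Nat using (min; max; argmin-all; argmax-all; min≤⊤; min≤xs; ⊥≤max; xs≤max)
open import Data.Product using (∃; _×_; _,_; proj₁; proj₂)
open import Function using (_∘_; id)
open import Relation.Unary using (Pred; Decidable)
open import Relation.Nullary using (¬_; ¬?; Dec; yes; no; does; contradiction)
open import Relation.Nullary.Decidable using (_×-dec_; map′; dec-true)
open import Relation.Binary.PropositionalEquality using (_≡_; refl; sym; trans; cong; subst)

open import Defs

private
  variable
    a b ℓ : Level
    A : Set a
    B : Set b
    σ m n : ℕ

x∈p⇒p∩⁅x⁆≡⁅x⁆ : ∀ {x : Fin σ} {p : Subset σ} → x ∈ p → p ∩ ⁅ x ⁆ ≡ ⁅ x ⁆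
x∈p⇒p∩⁅x⁆≡⁅x⁆ {x = x} {p} x∈p = ⊆-antisym (p∩q⊆q p ⁅ x ⁆) ⁅x⁆⊆p∩⁅x⁆
  where
  ⁅x⁆⊆p∩⁅x⁆ : ⁅ x ⁆ ⊆ p ∩ ⁅ x ⁆
  ⁅x⁆⊆p∩⁅x⁆ y∈⁅x⁆ with refl ← x∈⁅y⁆⇒x≡y x y∈⁅x⁆ = x∈p∩q⁺ (x∈p , y∈⁅x⁆)

x∈p∧∣p∣≡1⇒p≡⁅x⁆ : ∀ {x : Fin σ} {p : Subset σ} → x ∈ p → ∣ p ∣ ≡ 1 → p ≡ ⁅ x ⁆
x∈p∧∣p∣≡1⇒p≡⁅x⁆ {x = x} {p} x∈p ∣p∣≡1 = ⊆-antisym p⊆⁅x⁆ ⁅x⁆⊆p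
  where
  ⁅x⁆⊆p : ⁅ x ⁆ ⊆ p
  ⁅x⁆⊆p y∈⁅x⁆ with refl ← x∈⁅y⁆⇒x≡y x y∈⁅x⁆ = x∈p

  p⊆⁅x⁆ : p ⊆ ⁅ x ⁆
  p⊆⁅x⁆ {y} y∈p with y Fin.≟ x
  ... | yes refl = x∈⁅x⁆ x
  ... | no y≢x   = contradiction ∣⁅x⁆∣<∣p∣ (<-irrefl (trans (∣⁅x⁆∣≡1 x) (sym ∣p∣≡1)))
    where
    ∣⁅x⁆∣<∣p∣ : ∣ ⁅ x ⁆ ∣ < ∣ p ∣
    ∣⁅x⁆∣<∣p∣ = p⊂q⇒∣p∣<∣q∣ (⁅x⁆⊆p , y , y∈p , x≢y⇒x∉⁅y⁆ y≢x)

Window : ℕ → ℕ → ℕ → Set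
Window m z i = z ≤ i × i < z + m

extremes : List ℕ → List ℕ
extremes []       = []
extremes (x ∷ xs) = min x xs ∷ max x xs ∷ []

length-extremes≤2 : ∀ xs → length (extremes xs) ≤ 2
length-extremes≤2 []      = z≤n
length-extremes≤2 (_ ∷ _) = ≤-refl

All-extremes : ∀ {P : Pred ℕ ℓ} {xs} → All P xs → All P (extremes xs)
All-extremes []         = []
All-extremes (px ∷ pxs) = argmin-all id px pxs ∷ argmax-all id px pxs ∷ []

Any-if-true : ∀ {P : Pred A ℓ} {c xs} → c ≡ true → Any P xs → Any P (if c then xs else [])
Any-if-true refl pxs = pxs

-- Left of p the window at min xs reaches furthest, right of p the one at max xs.
extremes-window : ∀ {xs j i} p → All (λ z → Window m z p) xs → j ∈ˡ xs →
                  Window m j i → Any (λ z → Window m z i) (extremes xs)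
extremes-window {m} {x ∷ xs} {j} {i} p windows j∈xs (j≤i , i<j+m) with i ≤? p
... | yes i≤p = here (≤-trans min≤j j≤i , ≤-<-trans i≤p (proj₂ window-min))
  where
  min≤j : min x xs ≤ j
  min≤j = All.lookup (min≤⊤ x xs ∷ min≤xs x xs) j∈xs
  window-min : Window m (min x xs) p
  window-min = argmin-all id (All.head windows) (All.tail windows)
... | no  i≰p = there (here (≤-trans (proj₁ window-max) (<⇒≤ (≰⇒> i≰p)) ,
                             <-≤-trans i<j+m (+-monoˡ-≤ m j≤max)))
  where
  j≤max : j ≤ max x xs
  j≤max = All.lookup (⊥≤max x xs ∷ xs≤max x xs) j∈xs
  window-max : Window m (max x xs) p
  window-max = argmax-all id (All.head windows) (All.tail windows)

All-if : ∀ {P : Pred A ℓ} (c : Bool) {xs} → All P xs → All P (if c then xs else [])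
All-if true  pxs = pxs
All-if false _   = []

length-concat-tabulate-if≤ : ∀ {P : Pred A ℓ} (P? : Decidable P) (xs : Vec A n)
  (ys : Fin n → List B) {c} → (∀ i → length (ys i) ≤ c) →
  length (concat (tabulate (λ i → if does (P? (lookup xs i)) then ys i else [])))
    ≤ c * count P? xs
length-concat-tabulate-if≤ P? []       ys _ = z≤n
length-concat-tabulate-if≤ {B = B} P? (x ∷ xs) ys {c} ys≤c with does (P? x)
... | false = length-concat-tabulate-if≤ P? xs (ys ∘ Fin.suc) (ys≤c ∘ Fin.suc)
... | true  = begin
  length (ys Fin.zero ++ rest)         ≡⟨ length-++ (ys Fin.zero) ⟩
  length (ys Fin.zero) + length rest   ≤⟨ +-mono-≤ (ys≤c Fin.zero) rest≤ ⟩
  c + c * count P? xs                  ≡⟨ *-suc c (count P? xs) ⟨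
  c * suc (count P? xs)                ∎
  where
  open ≤-Reasoning
  rest : List B
  rest = concat (tabulate (λ i → if does (P? (lookup xs i)) then ys (Fin.suc i) else []))
  rest≤ : length rest ≤ c * count P? xs
  rest≤ = length-concat-tabulate-if≤ P? xs (ys ∘ Fin.suc) (ys≤c ∘ Fin.suc)

nonSolid? : Decidable {A = Subset σ} (λ q → ¬ ∣ q ∣ ≡ 1)
nonSolid? q = ¬? (∣ q ∣ ≟ 1)

window-pos : ∀ j (t : Fin m) (le : j + m ≤ n) → Window m j (toℕ (pos j t le))
window-pos {m} j t le rewrite toℕ-fromℕ< (<-≤-trans (+-monoʳ-< j (toℕ<n t)) le) =
  m≤m+n j (toℕ t) , +-monoʳ-< j (toℕ<n t)

IsCover⇒OccursAt0 : ∀ {T : IString σ n} {S : Solid σ m} → IsCover S T → Fin n → OccursAt S T 0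
IsCover⇒OccursAt0 {n = suc _} cover _ with cover Fin.zero
... | .0 , occ , z≤n , _ = occ

module Occurrences (T : IString σ n) (S : Solid σ m) where

  -- With an occurrence at 0, T[t] ∩ T[j + t] = T[t] ∩ {S[t]} = {S[t]}.
  solid-occurrence⇒IsOdotPrefix : ∀ {j} →
    OccursAt S T 0 → ((le , _) : OccursAt S T j) → (∀ t → ∣ lookup T (pos j t le) ∣ ≡ 1) →
    IsOdotPrefix S T
  solid-occurrence⇒IsOdotPrefix {j} (m≤n , S⊆T₀) (le , S⊆Tⱼ) solid =
    m≤n , j , le , λ t → (lookup S t , subst (lookup S t ∈_) (sym (meet t)) (x∈⁅x⁆ _)) , meet t
    where
    meet : ∀ t → lookup T (pos 0 t m≤n) ∩ lookup T (pos j t le) ≡ ⁅ lookup S t ⁆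
    meet t = trans (cong (lookup T (pos 0 t m≤n) ∩_) (x∈p∧∣p∣≡1⇒p≡⁅x⁆ (S⊆Tⱼ t) (solid t)))
                   (x∈p⇒p∩⁅x⁆≡⁅x⁆ (S⊆T₀ t))

  occurrence-meets-nonSolid : ∀ {j} →
    IsCover S T → ¬ IsOdotPrefix S T → Fin n → ((le , _) : OccursAt S T j) →
    ∃ λ t → ¬ ∣ lookup T (pos j t le) ∣ ≡ 1
  occurrence-meets-nonSolid {j} cover ¬prefix i occ@(le , _)
    with all? (λ t → ∣ lookup T (pos j t le) ∣ ≟ 1)
  ... | yes solid = contradiction (solid-occurrence⇒IsOdotPrefix occ₀ occ solid) ¬prefix
    where
    occ₀ : OccursAt S T 0
    occ₀ = IsCover⇒OccursAt0 {T = T} {S = S} cover i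
  ... | no ¬solid = ¬∀⟶∃¬ m _ (λ t → ∣ lookup T (pos j t le) ∣ ≟ 1) ¬solid

  occursAt? : ∀ j → Dec (OccursAt S T j)
  occursAt? j with j + m ≤? n
  ... | no  j+m≰n = no (j+m≰n ∘ proj₁)
  ... | yes le    = map′ (le ,_) (λ (le′ , S⊆T) → subst (S⊆T-at j) (≤-irrelevant le′ le) S⊆T)
                         (all? λ t → lookup S t ∈? lookup T (pos j t le))
    where
    S⊆T-at : ∀ j → j + m ≤ n → Set
    S⊆T-at j le = ∀ t → lookup S t ∈ lookup T (pos j t le)

  occursThrough? : ∀ p j → Dec (OccursAt S T j × Window m j p)
  occursThrough? p j = occursAt? j ×-dec (j ≤? p ×-dec p <? j + m)

  occurrencesThrough : ℕ → List ℕ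
  occurrencesThrough p = filter (occursThrough? p) (upTo (suc p))

  ∈-occurrencesThrough : ∀ {p j} → OccursAt S T j → Window m j p → j ∈ˡ occurrencesThrough p
  ∈-occurrencesThrough occ window@(j≤p , _) =
    ∈-filter⁺ (occursThrough? _) (∈-upTo⁺ (s≤s j≤p)) (occ , window)

  All-occurrencesThrough : ∀ p → All (λ j → OccursAt S T j × Window m j p) (occurrencesThrough p)
  All-occurrencesThrough p = all-filter (occursThrough? p) (upTo (suc p))

  coveringSet : List ℕ
  coveringSet = concat (tabulate λ i →
    if does (nonSolid? (lookup T i)) then extremes (occurrencesThrough (toℕ i)) else [])

  coveringSet-occurs : All (OccursAt S T) coveringSet
  coveringSet-occurs = concat⁺ (tabulate⁺ λ i →
    All-if (does (nonSolid? (lookup T i)))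
           (All.map proj₁ (All-extremes (All-occurrencesThrough (toℕ i)))))

  coveringSet-covers : IsCover S T → ¬ IsOdotPrefix S T → ∀ i → CoveredBy m coveringSet i
  coveringSet-covers cover ¬prefix i with cover i
  ... | j , occ@(le , _) , j≤i , i<j+m with occurrence-meets-nonSolid cover ¬prefix i occ
  ... | t , p-nonSolid =
    Any.concat⁺ (Any.tabulate⁺ p (Any-if-true (dec-true (nonSolid? (lookup T p)) p-nonSolid)
      (extremes-window (toℕ p) (All.map proj₂ (All-occurrencesThrough (toℕ p)))
        (∈-occurrencesThrough occ (window-pos j t le)) (j≤i , i<j+m))))
    where
    p : Fin n
    p = pos j t le

  length-coveringSet : length coveringSet ≤ 2 * nonSolid T
  length-coveringSet = length-concat-tabulate-if≤ nonSolid? T _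
    (λ i → length-extremes≤2 (occurrencesThrough (toℕ i)))

-- Nonemptiness of the entries of T is never used.
lemma4 : ∀ {σ n m} (T : IString σ n) (S : Solid σ m) (k : ℕ) →
    IsIString T → nonSolid T ≡ k → IsCover S T → ¬ IsOdotPrefix S T →
    ∃ λ (C : List ℕ) → IsCoveringSet S T C × length C ≤ 2 * k
lemma4 T S k _ refl cover ¬prefix =
  coveringSet , (coveringSet-occurs , coveringSet-covers cover ¬prefix) , length-coveringSet
  where open Occurrences T S
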